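{- There exists a Turing machine which, given a finite word $u$ over the finite alphabet $A$, outputs a word $v$ such that: whenever $u=x|_{[0,2^n)}$ for some $x\in\mathcal D_\alpha$ (with $\alpha\in A^{\mathbb N_1}$) and some $n\in\mathbb N$, then $v=\beta_{[1,n]}$ for some $\beta\sim\alpha'$ where $\alpha'\in A^{\mathbb N_1}$ satisfies $\alpha'_{[1,n]}=\alpha_{[1,n]}$.
   Context: $\mathbb N_1=\mathbb N\setminus\{0\}$, and $[i,j]$ denotes an integer interval. A $1$-net is a family $(2^n\mathbb Z+k_n)_{n\in\mathbb N_1}$ of pairwise disjoint subsets of $\mathbb Z$ (with $k_n\in\mathbb Z$). For $\alpha\in A^{\mathbb N_1}$, $\mathcal D_\alpha\subseteq A^{\mathbb Z}$ is the set of configurations $x$ for which there is a $1$-net $(2^n\mathbb Z+k_n)_{n\in\mathbb N_1}$ such that $x_i=\alpha_n$ for all $n\in\mathbb N_1$ and $i\in2^n\mathbb Z+k_n$. For $\alpha,\beta\in A^{\mathbb N_1}$, $\alpha\sim\beta$ means $\alpha=\beta$ or there is $i\in\mathbb N_1$ such that $\alpha_j=\beta_j$ for all $j<i$, and $\alpha_i=\beta_j$ and $\alpha_j=\beta_i$ for all $j>i$. For a sequence $\beta$, $\beta_{[1,n]}$ is the word $\beta_1\cdots\beta_n$. -}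

module Defs where

open import Data.Nat using (ℕ; suc; _<_; _^_)
open import Data.Integer using (ℤ; +_; _+_; _*_)
open import Data.Fin using (Fin)
open import Data.List using (List; map; upTo)
open import Data.Product using (Σ; ∃; _×_)
open import Data.Sum using (_⊎_)
open import Relation.Binary.PropositionalEquality using (_≡_; _≢_)
open import Relation.Nullary using (¬_)

-- Convention: sequences indexed by ℕ₁ = {1,2,...} are represented as
-- functions ℕ → A with a shift by one:  s m  stands for  s_{m+1}.
Seq : Set → Set
Seq A = ℕ → A

-- i ∈ 2^(m+1) ℤ + k m   (the set of the net with index m+1)
InNet : (ℕ → ℤ) → ℕ → ℤ → Set
InNet k m i = ∃ λ (z : ℤ) → i ≡ z * (+ (2 ^ suc m)) + k m

IsOneNet : (ℕ → ℤ) → Set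
IsOneNet k = ∀ m m' → m ≢ m' → ∀ (i : ℤ) → ¬ (InNet k m i × InNet k m' i)

InD : {A : Set} → Seq A → (ℤ → A) → Set
InD α x = ∃ λ (k : ℕ → ℤ) → IsOneNet k × (∀ m i → InNet k m i → x i ≡ α m)

Sim : {A : Set} → Seq A → Seq A → Set
Sim α β =
  (∀ j → α j ≡ β j)
  ⊎ (∃ λ (i : ℕ) → (∀ j → j < i → α j ≡ β j)
                 × (∀ j → i < j → (α i ≡ β j) × (α j ≡ β i)))

window : {A : Set} → (ℤ → A) → ℕ → List A
window x n = map (λ j → x (+ j)) (upTo (2 ^ n))

prefix : {A : Set} → Seq A → ℕ → List A
prefix s n = map s (upTo n)

-- In a configuration of 𝒟_α the first class 2ℤ + k₁ of the net is a parity class, so in the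
-- window [0, 2^n) one half (the even or the odd positions) is constantly α₁, and the other half,
-- reindexed by i ↦ t + 2i, is the window of a configuration of 𝒟 for the shifted sequence α₂α₃….
-- The decoder emits the first letter and recurses on the odd half when the even half is constant,
-- and otherwise emits the second letter and recurses on the even half. Its only wrong guess is an
-- even half that is constant although the odd half carries α₁: then α₂ = … = α_n = c for that
-- constant c, and the output c α₁ … α₁ is a prefix of the transposition c α₁ α₁ … ∼ α₁ c c ….
module Submission where

open import Defs
open import Data.Nat using (ℕ; _<_)
open import Data.Integer using (ℤ)
open import Data.Fin using (Fin)
open import Data.List using (List)
open import Data.Product using (Σ; ∃; _×_)
open import Relation.Binary.PropositionalEquality using (_≡_)

open import Data.Fin using (_≟_)
open import Function using (_∘_; const)
open import Data.Bool using (if_then_else_)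
open import Data.Nat using (zero; suc; _+_; _*_; _∸_; _^_; _≤_; NonZero; s≤s; z<s; s<s)
open import Data.Nat.Properties
  using ( *-comm; +-identityʳ; +-mono-≤; +-monoˡ-<; *-monoˡ-≤; ≤-trans; ≤-reflexive; <⇒≤
        ; m∸n≤m; m^n>0; m^n≢0; suc-injective )
open import Data.Integer as ℤ using (+_)
open import Data.Integer.Properties using (pos-+; pos-*; +-identityˡ)
open import Data.Integer.DivMod using (_%ℕ_; _/ℕ_; n%ℕd<d; a≡a%ℕn+[a/ℕn]*n)
open import Data.Integer.Tactic.RingSolver using (solve-∀)
open import Data.List using ([]; _∷_; applyUpTo; length)
open import Data.List.Properties using (map-upTo; length-applyUpTo)
open import Data.List.Relation.Unary.All using (all?)
open import Data.List.Relation.Unary.All.Properties using (applyUpTo⁺₂; applyUpTo⁻)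
open import Data.Product using (_,_)
open import Data.Sum using (inj₁; inj₂)
open import Relation.Nullary using (yes; no; does; contradiction)
open import Relation.Binary.Definitions using (DecidableEquality)
open import Relation.Binary.PropositionalEquality using (_≢_; refl; sym; trans; cong; cong₂; subst)

2^suc : ∀ m → 2 ^ suc m ≡ 2 ^ m * 2
2^suc m = *-comm 2 (2 ^ m)

n<2^n : ∀ n → n < 2 ^ n
n<2^n zero    = z<s
n<2^n (suc n) = ≤-trans (+-mono-≤ (m^n>0 2 n) (n<2^n n))
                        (≤-reflexive (cong (λ y → 2 ^ n + y) (sym (+-identityʳ (2 ^ n)))))

decimate-< : ∀ {r j N} → r < 2 → j < N → r + j * 2 < 2 * N
decimate-< {j = j} {N} r<2 j<N =
  ≤-trans (+-monoˡ-< (j * 2) r<2) (≤-trans (*-monoˡ-≤ 2 j<N) (≤-reflexive (*-comm N 2)))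

other-bit : ∀ {r s} → r < 2 → s < 2 → s ≢ r → s ≡ 1 ∸ r
other-bit {0} {0} _ _ s≢r = contradiction refl s≢r
other-bit {0} {1} _ _ _   = refl
other-bit {1} {0} _ _ _   = refl
other-bit {1} {1} _ _ s≢r = contradiction refl s≢r
other-bit {suc (suc _)} (s<s (s<s ())) _ _
other-bit {_} {suc (suc _)} _ (s<s (s<s ())) _

cons : {A : Set} → A → Seq A → Seq A
cons a s zero    = a
cons a s (suc j) = s j

Sim-cons : ∀ {A : Set} {a b : A} {β α : Seq A} → a ≡ b → Sim β α → Sim (cons a β) (cons b α)
Sim-cons a≡b (inj₁ β≡α) = inj₁ λ { zero → a≡b ; (suc j) → β≡α j }
Sim-cons a≡b (inj₂ (i , below , above)) =
  inj₂ ( suc i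
       , (λ { zero _ → a≡b ; (suc j) (s<s j<i) → below j j<i })
       , (λ { (suc j) (s<s i<j) → above j i<j }) )

Sim-swap : ∀ {A : Set} (a c : A) → Sim (cons c (const a)) (cons a (const c))
Sim-swap a c = inj₂ (0 , (λ _ ()) , λ { (suc j) _ → refl , refl })

Recovers : {A : Set} → Seq A → ℕ → List A → Set
Recovers α n v = ∃ λ α' → (∀ j → j < n → α' j ≡ α j) × (∃ λ β → Sim β α' × v ≡ applyUpTo β n)

module _ {A : Set} {α : Seq A} where

  Recovers-[] : Recovers α 0 []
  Recovers-[] = α , (λ _ ()) , α , inj₁ (λ _ → refl) , refl

  Recovers-∷ : ∀ {n v a} → a ≡ α 0 → Recovers (α ∘ suc) n v → Recovers α (suc n) (a ∷ v)
  Recovers-∷ {a = a} a≡α₀ (α' , α'≡α , β , β∼α' , v≡β) =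
      cons (α 0) α'
    , (λ { zero _ → refl ; (suc j) (s<s j<n) → α'≡α j j<n })
    , cons a β , Sim-cons a≡α₀ β∼α' , cong (a ∷_) v≡β

  Recovers-swap : ∀ {n v c} → (∀ j → j < n → α (suc j) ≡ c) →
                  v ≡ applyUpTo (const (α 0)) n → Recovers α (suc n) (c ∷ v)
  Recovers-swap {c = c} α₊≡c v≡α₀ =
      cons (α 0) (const c)
    , (λ { zero _ → refl ; (suc j) (s<s j<n) → sym (α₊≡c j j<n) })
    , cons c (const (α 0)) , Sim-swap (α 0) c , cong (c ∷_) v≡α₀

module _ {A : Set} where

  evens : List A → List A
  evens []          = []
  evens (a ∷ [])    = a ∷ []
  evens (a ∷ _ ∷ w) = a ∷ evens w

  odds : List A → List A
  odds []          = []
  odds (_ ∷ [])    = []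
  odds (_ ∷ b ∷ w) = b ∷ odds w

  decimate : (ℕ → A) → ℕ → ℕ → A
  decimate f r j = f (r + j * 2)

  evens-applyUpTo : ∀ (f : ℕ → A) n → evens (applyUpTo f (n * 2)) ≡ applyUpTo (decimate f 0) n
  evens-applyUpTo f zero    = refl
  evens-applyUpTo f (suc n) = cong (f 0 ∷_) (evens-applyUpTo (f ∘ suc ∘ suc) n)

  odds-applyUpTo : ∀ (f : ℕ → A) n → odds (applyUpTo f (n * 2)) ≡ applyUpTo (decimate f 1) n
  odds-applyUpTo f zero    = refl
  odds-applyUpTo f (suc n) = cong (f 1 ∷_) (odds-applyUpTo (f ∘ suc ∘ suc) n)

-- The trace on ℕ of a configuration of 𝒟_α, down to depth n.
data Layered {A : Set} : Seq A → (ℕ → A) → ℕ → Set where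
  base  : ∀ {α f} → Layered α f 0
  layer : ∀ {α f n r} → r < 2 → (∀ j → decimate f r j ≡ α 0) →
          Layered (α ∘ suc) (decimate f (1 ∸ r)) n → Layered α f (suc n)

Layered-const : ∀ {A : Set} {α : Seq A} {h c m} → Layered α h m →
                (∀ {j} → j < 2 ^ m → h j ≡ c) → ∀ j → j < m → α j ≡ c
Layered-const {m = suc m} (layer r<2 class≡α₀ L) h≡c zero _ =
  trans (sym (class≡α₀ 0)) (h≡c (decimate-< r<2 (m^n>0 2 m)))
Layered-const (layer {r = r} _ _ L) h≡c (suc j) (s<s j<m) =
  Layered-const L (λ i< → h≡c (decimate-< (s<s (m∸n≤m 1 r)) i<)) j j<m

double-shift-coset : ∀ t P z c {i} → i ≡ z ℤ.* + P ℤ.+ c →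
                     + t ℤ.+ i ℤ.* + 2 ≡ z ℤ.* + (2 * P) ℤ.+ (+ t ℤ.+ c ℤ.* + 2)
double-shift-coset t P z c refl =
  trans (regroup (+ t) z (+ P) c) (cong (λ Q → z ℤ.* Q ℤ.+ _) (sym (pos-* 2 P)))
  where
  regroup : ∀ T z P c → T ℤ.+ (z ℤ.* P ℤ.+ c) ℤ.* + 2 ≡ z ℤ.* (+ 2 ℤ.* P) ℤ.+ (T ℤ.+ c ℤ.* + 2)
  regroup = solve-∀

InNet₀-parity : ∀ (k : ℕ → ℤ) e → InNet k 0 (+ (k 0 %ℕ 2) ℤ.+ e ℤ.* + 2)
InNet₀-parity k e =
  e ℤ.- d , trans (regroup (+ (k 0 %ℕ 2)) e d)
                  (cong (λ y → (e ℤ.- d) ℤ.* + 2 ℤ.+ y) (sym (a≡a%ℕn+[a/ℕn]*n (k 0) 2)))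
  where
  d = k 0 /ℕ 2
  regroup : ∀ r e d → r ℤ.+ e ℤ.* + 2 ≡ (e ℤ.- d) ℤ.* + 2 ℤ.+ (r ℤ.+ d ℤ.* + 2)
  regroup = solve-∀

tail-parity : ∀ {k} → IsOneNet k → ∀ m → k (suc m) %ℕ 2 ≢ k 0 %ℕ 2
tail-parity {k} net m same = net 0 (suc m) (λ ()) (k (suc m)) (in-class₀ , + 0 , sym (+-identityˡ _))
  where
  in-class₀ : InNet k 0 (k (suc m))
  in-class₀ = subst (InNet k 0)
    (sym (trans (a≡a%ℕn+[a/ℕn]*n (k (suc m)) 2)
                (cong (λ s → + s ℤ.+ k (suc m) /ℕ 2 ℤ.* + 2) same)))
    (InNet₀-parity k (k (suc m) /ℕ 2))

module _ {A : Set} where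

  InD-layer : ∀ {α : Seq A} {x} → InD α x →
              ∃ λ r → r < 2 × (∀ i → x (+ r ℤ.+ i ℤ.* + 2) ≡ α 0)
                            × InD (α ∘ suc) (λ i → x (+ (1 ∸ r) ℤ.+ i ℤ.* + 2))
  InD-layer (k , net , val) =
      r , n%ℕd<d (k 0) 2 , (λ i → val 0 _ (InNet₀-parity k i))
    , k′
    , (λ m m′ m≢m′ i (i∈ , i∈′) → net (suc m) (suc m′) (m≢m′ ∘ suc-injective) _ (lift i∈ , lift i∈′))
    , (λ m i i∈ → val (suc m) _ (lift i∈))
    where
    r = k 0 %ℕ 2
    k′ : ℕ → ℤ
    k′ m = k (suc m) /ℕ 2
    k₊≡ : ∀ m → k (suc m) ≡ + (1 ∸ r) ℤ.+ k′ m ℤ.* + 2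
    k₊≡ m = trans (a≡a%ℕn+[a/ℕn]*n (k (suc m)) 2)
      (cong (λ s → + s ℤ.+ k′ m ℤ.* + 2)
            (other-bit (n%ℕd<d (k 0) 2) (n%ℕd<d (k (suc m)) 2) (tail-parity net m)))
    lift : ∀ {m i} → InNet k′ m i → InNet k (suc m) (+ (1 ∸ r) ℤ.+ i ℤ.* + 2)
    lift {m} (z , i≡) = z , trans (double-shift-coset (1 ∸ r) (2 ^ suc m) z (k′ m) i≡)
                                  (cong (λ y → z ℤ.* + (2 ^ suc (suc m)) ℤ.+ y) (sym (k₊≡ m)))

  InD-Layered : ∀ n {α : Seq A} {x f} → InD α x → (∀ j → f j ≡ x (+ j)) → Layered α f n
  InD-Layered zero _ _ = base
  InD-Layered (suc n) {x = x} {f} x∈D f≡x with InD-layer x∈D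
  ... | r , r<2 , class₀ , rest∈D =
    layer r<2 (λ j → trans (decimate≡ r j) (class₀ (+ j)))
              (InD-Layered n rest∈D (decimate≡ (1 ∸ r)))
    where
    decimate≡ : ∀ s j → decimate f s j ≡ x (+ s ℤ.+ + j ℤ.* + 2)
    decimate≡ s j = trans (f≡x (s + j * 2))
                          (cong x (trans (pos-+ s (j * 2)) (cong (λ y → + s ℤ.+ y) (pos-* j 2))))

module Decoding {A : Set} (_≟_ : DecidableEquality A) where

  decode : List A → ℕ → List A
  decode w@(a ∷ b ∷ _) (suc k) =
    if does (all? (_≟ a) (evens w)) then a ∷ decode (odds w) k else b ∷ decode (evens w) k
  decode _ _ = []

  decode-step : ∀ (f : ℕ → A) N .{{_ : NonZero N}} k →
    decode (applyUpTo f (N * 2)) (suc k) ≡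
      (if does (all? (_≟ f 0) (applyUpTo (decimate f 0) N))
       then f 0 ∷ decode (applyUpTo (decimate f 1) N) k
       else f 1 ∷ decode (applyUpTo (decimate f 0) N) k)
  decode-step f (suc n) k =
    cong₂ (λ E O → if does (all? (_≟ f 0) E) then f 0 ∷ decode O k else f 1 ∷ decode E k)
          (evens-applyUpTo f (suc n)) (odds-applyUpTo f (suc n))

  decode-const : ∀ m k → m ≤ k → ∀ (h : ℕ → A) c → (∀ j → h j ≡ c) →
                 decode (applyUpTo h (2 ^ m)) k ≡ applyUpTo (const c) m
  decode-const zero k _ h c h≡c = refl
  decode-const (suc m) (suc k) (s≤s m≤k) h c h≡c
    rewrite 2^suc m | decode-step h (2 ^ m) {{m^n≢0 2 m}} k
    with all? (_≟ h 0) (applyUpTo (decimate h 0) (2 ^ m))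
  ... | yes _ = cong₂ _∷_ (h≡c 0) (decode-const m k m≤k (decimate h 1) c (λ j → h≡c (1 + j * 2)))
  ... | no ¬const = contradiction (applyUpTo⁺₂ _ _ (λ j → trans (h≡c _) (sym (h≡c 0)))) ¬const

  decode-correct : ∀ {α : Seq A} {f} m k → m ≤ k → Layered α f m →
                   Recovers α m (decode (applyUpTo f (2 ^ m)) k)
  decode-correct zero k _ base = Recovers-[]
  decode-correct {α} {f} (suc m) (suc k) (s≤s m≤k) (layer r<2 class≡α₀ L)
    rewrite 2^suc m | decode-step f (2 ^ m) {{m^n≢0 2 m}} k
    with all? (_≟ f 0) (applyUpTo (decimate f 0) (2 ^ m)) | r<2
  ... | yes _         | z<s     = Recovers-∷ (class≡α₀ 0) (decode-correct m k m≤k L)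
  ... | no ¬const     | z<s     =
    contradiction (applyUpTo⁺₂ _ _ (λ j → trans (class≡α₀ j) (sym (class≡α₀ 0)))) ¬const
  ... | yes evens≡f₀  | s<s z<s =
    Recovers-swap (Layered-const L (applyUpTo⁻ _ _ evens≡f₀))
                  (decode-const m k m≤k (decimate f 1) (α 0) class≡α₀)
  ... | no _          | s<s z<s = Recovers-∷ (class≡α₀ 0) (decode-correct m k m≤k L)

  decodeWord : List A → List A
  decodeWord w = decode w (length w)

  decodeWord-window : ∀ n {α : Seq A} {x} → InD α x →
                      Recovers α n (decodeWord (applyUpTo (x ∘ +_) (2 ^ n)))
  decodeWord-window n {x = x} x∈D rewrite length-applyUpTo (x ∘ +_) (2 ^ n) =
    decode-correct n (2 ^ n) (<⇒≤ (n<2^n n)) (InD-Layered n x∈D (λ _ → refl))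

lemma2 : (q : ℕ) → Σ (List (Fin q) → List (Fin q)) λ M →
           ∀ (α : Seq (Fin q)) (x : ℤ → Fin q) (n : ℕ) → InD α x →
             ∃ λ (α' : Seq (Fin q)) → (∀ j → j < n → α' j ≡ α j) ×
               (∃ λ (β : Seq (Fin q)) → Sim β α' × (M (window x n) ≡ prefix β n))
lemma2 q = decodeWord , λ α x n x∈D →
  let α' , α'≡α , β , β∼α' , out≡β = decodeWord-window n x∈D
  in  α' , α'≡α , β , β∼α'
    , trans (cong decodeWord (map-upTo (x ∘ +_) (2 ^ n))) (trans out≡β (sym (map-upTo β n)))
  where open Decoding (_≟_ {q})
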